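{- Let $\ast$ be a uniformity preserving operation on a finite set $\mathcal{X}$. If $\mathcal{H}$ is a periodic partition of $(\mathcal{X},\ast)$, then $|\mathcal{H}^{n\ast}|=|\mathcal{H}|$ for every $n>0$.
   Context: $\ast$ is uniformity preserving if for every $b$ the map $x\mapsto x\ast b$ is a bijection of $\mathcal{X}$. For $A,B\subset\mathcal{X}$, $A\ast B=\{a\ast b:a\in A,b\in B\}$. For a set $\mathcal{H}$ of subsets of $\mathcal{X}$, $\mathcal{H}^{\ast}=\{A\ast B:A,B\in\mathcal{H}\}$, $\mathcal{H}^{0\ast}=\mathcal{H}$, $\mathcal{H}^{n\ast}=(\mathcal{H}^{(n-1)\ast})^{\ast}$. A partition $\mathcal{H}$ of $\mathcal{X}$ is periodic if $\mathcal{H}^{n\ast}=\mathcal{H}$ for some $n>0$. $|\mathcal{H}|$ denotes the number of elements of $\mathcal{H}$. -}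

module Defs where

open import Data.Nat using (ℕ; zero; suc)
open import Data.Bool using (Bool; true; false; _∧_; T)
open import Data.Fin using (Fin)
open import Data.Fin.Properties using () renaming (_≟_ to _≟ᶠ_)
open import Data.Fin.Subset using (Subset; _∈_; Nonempty)
open import Data.Vec using (Vec; []; _∷_; tabulate; lookup)
open import Data.Vec.Properties using (≡-dec)
open import Data.Bool.Properties using () renaming (_≟_ to _≟ᵇ_)
open import Data.List using (List; []; _∷_; _++_; map; allFin; length; filterᵇ)
open import Data.Bool.ListAction using (any)
open import Data.Product using (Σ; ∃; _×_; _,_)
open import Function.Definitions using (Bijective)
open import Relation.Binary.PropositionalEquality using (_≡_)
open import Relation.Nullary using (does)

-- The finite set 𝒳 is modelled as Fin k; a binary operation is  Fin k → Fin k → Fin k.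
Op : ℕ → Set
Op k = Fin k → Fin k → Fin k

UniformityPreserving : ∀ {k} → Op k → Set
UniformityPreserving {k} _∗_ = ∀ (b : Fin k) → Bijective _≡_ _≡_ (λ x → x ∗ b)

allSubsets : ∀ k → List (Subset k)
allSubsets zero = [] ∷ []
allSubsets (suc k) = map (true ∷_) (allSubsets k) ++ map (false ∷_) (allSubsets k)

_⟪_⟫_ : ∀ {k} → Subset k → Op k → Subset k → Subset k
_⟪_⟫_ {k} A _∗_ B =
  tabulate λ x → any (λ a → any (λ b → lookup A a ∧ lookup B b ∧ does ((a ∗ b) ≟ᶠ x)) (allFin k)) (allFin k)

Family : ℕ → Set
Family k = Subset k → Bool

_∈ᶠ_ : ∀ {k} → Subset k → Family k → Set
A ∈ᶠ ℋ = T (ℋ A)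

star : ∀ {k} → Op k → Family k → Family k
star {k} _∗_ ℋ C =
  any (λ A → any (λ B → ℋ A ∧ ℋ B ∧ does (≡-dec _≟ᵇ_ (A ⟪ _∗_ ⟫ B) C)) (allSubsets k)) (allSubsets k)

starN : ∀ {k} → Op k → ℕ → Family k → Family k
starN _∗_ zero ℋ = ℋ
starN _∗_ (suc n) ℋ = star _∗_ (starN _∗_ n ℋ)

_≐_ : ∀ {k} → Family k → Family k → Set
_≐_ {k} ℋ 𝒢 = ∀ (A : Subset k) → ℋ A ≡ 𝒢 A

card : ∀ {k} → Family k → ℕ
card {k} ℋ = length (filterᵇ ℋ (allSubsets k))

IsPartition : ∀ {k} → Family k → Set
IsPartition {k} ℋ =
  (∀ A → A ∈ᶠ ℋ → Nonempty A) ×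
  (∀ (x : Fin k) → Σ (Subset k) λ A → A ∈ᶠ ℋ × x ∈ A) ×
  (∀ (x : Fin k) A B → A ∈ᶠ ℋ → B ∈ᶠ ℋ → x ∈ A → x ∈ B → A ≡ B)

Periodic : ∀ {k} → Op k → Family k → Set
Periodic _∗_ ℋ = ∃ λ n → starN _∗_ (suc n) ℋ ≐ ℋ

-- Fix c ∈ 𝒳 and let ρ x = x ∗ c ∗ ⋯ ∗ c (n factors); ρ is a permutation, and we show
-- ℋ^{n∗} = { ρ A : A ∈ ℋ }, which gives |ℋ^{n∗}| = |ℋ|.
--
-- If ℋ^{l∗} = ℋ, right translation by any word of length l maps every block into a block,
-- since the translate of a block lies in a member of ℋ^{l∗}.  Being a permutation of a finite
-- set, such a translation has a power equal to the identity on any two given points, so it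
-- also reflects "lying in a common block".  Now a member E of ℋ^{n∗} contains the translate of
-- some block by a word gs of length n, and translating E further by a word of length np
-- (p + 1 being the period) lands it inside a block.  Comparing with ρ through the reflection
-- property for words of length n(p + 1) shows that E is exactly ρ of a block; conversely ρ A
-- lies in a member of ℋ^{n∗}, which must then be ρ A itself.
module Submission where

open import Defs
open import Data.Bool using (Bool; true; false; T)
open import Data.Bool.Properties using (T-≡; T-∧; ⇔→≡) renaming (_≟_ to _≟ᵇ_)
open import Data.Bool.ListAction using (any)
open import Data.Empty using (⊥)
open import Data.Fin using (Fin; zero; toℕ)
open import Data.Fin.Properties using (pigeonhole) renaming (_≟_ to _≟ᶠ_)
open import Data.Fin.Subset using (Subset; _∈_; _⊆_; Nonempty)
open import Data.Fin.Subset.Properties using (⊆-antisym)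
open import Data.List using (List; []; _∷_; _++_; map; length; filterᵇ; allFin; replicate)
open import Data.List.Membership.Propositional using (lose) renaming (_∈_ to _∈ₗ_)
open import Data.List.Membership.Propositional.Properties using (∈-allFin; ∈-map⁺; ∈-map⁻; ∈-++⁺ˡ; ∈-++⁺ʳ)
open import Data.List.Membership.Propositional.Properties.WithK using (unique∧set⇒bag)
open import Data.List.Properties using (length-map; length-++; length-replicate; filter-≐)
open import Data.List.Relation.Binary.BagAndSetEquality using (∼bag⇒↭)
open import Data.List.Relation.Binary.Permutation.Propositional using (_↭_)
open import Data.List.Relation.Binary.Permutation.Propositional.Properties using (↭-length; filter-↭)
open import Data.List.Relation.Unary.Any using (here; satisfied)
open import Data.List.Relation.Unary.Any.Properties using (any⁺; any⁻)
open import Data.List.Relation.Unary.Unique.Propositional using (Unique)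
open import Data.List.Relation.Unary.Unique.Propositional.Properties using (map⁺; ++⁺)
import Data.List.Relation.Unary.AllPairs as AllPairs
import Data.List.Relation.Unary.All as All
open import Data.Nat using (ℕ; zero; suc; _+_; _*_)
open import Data.Nat.GeneralisedArithmetic using (fold; fold-+; iterate-is-fold)
open import Data.Nat.Properties using (+-suc; +-comm; +-identityʳ; *-comm; *-suc; n<1+n; m≤n⇒∃[o]m+o≡n)
open import Data.Product using (∃; ∃₂; _×_; _,_; proj₁; proj₂)
open import Data.Vec using ([]; _∷_; tabulate; lookup)
open import Data.Vec.Properties using (lookup∘tabulate; []=⇒lookup; lookup⇒[]=; ∷-injectiveʳ; ≡-dec)
open import Function using (_∘_; id; mk⇔; Equivalence)
open import Function.Definitions using (Injective; Surjective; Bijective)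
import Function.Construct.Composition as Composition
import Function.Construct.Identity as Identity
open import Relation.Binary.PropositionalEquality
open import Relation.Nullary using (Dec; _because_; does)
open import Relation.Nullary.Decidable using (T?; dec-true)
open import Relation.Nullary.Reflects using (invert)

open Equivalence using (to; from)

T-injective : ∀ {a b} → (T a → T b) → (T b → T a) → a ≡ b
T-injective a⇒b b⇒a = ⇔→≡ (mk⇔ (to T-≡ ∘ a⇒b ∘ from T-≡) (to T-≡ ∘ b⇒a ∘ from T-≡))

T-does⁺ : ∀ {P : Set} (P? : Dec P) → P → T (does P?)
T-does⁺ P? = from T-≡ ∘ dec-true P?

T-does⁻ : ∀ {P : Set} (P? : Dec P) → T (does P?) → P
T-does⁻ (true because [p]) _ = invert [p]

T-any⁺ : ∀ {A : Set} (p : A → Bool) {x xs} → x ∈ₗ xs → T (p x) → T (any p xs)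
T-any⁺ p x∈xs px = any⁺ p (lose x∈xs px)

T-any⁻ : ∀ {A : Set} (p : A → Bool) xs → T (any p xs) → ∃ λ x → T (p x)
T-any⁻ p xs = satisfied ∘ any⁻ p xs

module _ {k} {f : Fin k → Fin k} (f-injective : Injective _≡_ _≡_ f) where

  fold-cancel : ∀ i {x y} → fold x f i ≡ fold y f i → x ≡ y
  fold-cancel zero    eq = eq
  fold-cancel (suc i) eq = fold-cancel i (f-injective eq)

  fold-returns : ∀ x → ∃ λ d → fold x f (suc d) ≡ x
  fold-returns x
    with i , j , i<j , fⁱx≡fʲx ← pigeonhole (n<1+n k) (λ i → fold x f (toℕ i))
    with o , i+o≡j ← m≤n⇒∃[o]m+o≡n i<j
    = o , fold-cancel (toℕ i) (begin
        fold (fold x f (suc o)) f (toℕ i) ≡⟨ fold-+ x f (toℕ i) ⟨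
        fold x f (toℕ i + suc o)          ≡⟨ cong (fold x f) (trans (+-suc (toℕ i) o) i+o≡j) ⟩
        fold x f (toℕ j)                  ≡⟨ fⁱx≡fʲx ⟨
        fold x f (toℕ i)                  ∎)
    where open ≡-Reasoning

fold-periodic : ∀ {A : Set} (f : A → A) {x} m → fold x f m ≡ x → ∀ t → fold x f (t * m) ≡ x
fold-periodic f m fᵐx≡x zero    = refl
fold-periodic f {x} m fᵐx≡x (suc t) = begin
  fold x f (m + t * m)        ≡⟨ fold-+ x f m ⟩
  fold (fold x f (t * m)) f m ≡⟨ cong (λ z → fold z f m) (fold-periodic f m fᵐx≡x t) ⟩
  fold x f m                  ≡⟨ fᵐx≡x ⟩
  x                           ∎
  where open ≡-Reasoning

fold-returns₂ : ∀ {k} {f : Fin k → Fin k} → Injective _≡_ _≡_ f →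
  ∀ x y → ∃ λ d → fold x f (suc d) ≡ x × fold y f (suc d) ≡ y
fold-returns₂ {f = f} f-injective x y
  with dx , fx ← fold-returns f-injective x
  with dy , fy ← fold-returns f-injective y
  = dx + dy * suc dx
  , fold-periodic f (suc dx) fx (suc dy)
  , subst (λ m → fold y f m ≡ y) (*-comm (suc dx) (suc dy)) (fold-periodic f (suc dy) fy (suc dx))

module _ {k} {A : Subset k} {x : Fin k} where

  ∈⇒T-lookup : x ∈ A → T (lookup A x)
  ∈⇒T-lookup = from T-≡ ∘ []=⇒lookup

  T-lookup⇒∈ : T (lookup A x) → x ∈ A
  T-lookup⇒∈ = lookup⇒[]= x A ∘ to T-≡

module _ {k} {p : Fin k → Bool} {x : Fin k} where

  ∈-tabulate⁺ : T (p x) → x ∈ tabulate p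
  ∈-tabulate⁺ = T-lookup⇒∈ ∘ subst T (sym (lookup∘tabulate p x))

  ∈-tabulate⁻ : x ∈ tabulate p → T (p x)
  ∈-tabulate⁻ = subst T (lookup∘tabulate p x) ∘ ∈⇒T-lookup

preimage : ∀ {k} → (Fin k → Fin k) → Subset k → Subset k
preimage f E = tabulate (lookup E ∘ f)

module _ {k} {f : Fin k → Fin k} {E : Subset k} {x : Fin k} where

  ∈-preimage⁺ : f x ∈ E → x ∈ preimage f E
  ∈-preimage⁺ = ∈-tabulate⁺ ∘ ∈⇒T-lookup

  ∈-preimage⁻ : x ∈ preimage f E → f x ∈ E
  ∈-preimage⁻ = T-lookup⇒∈ ∘ ∈-tabulate⁻

preimage-bijective : ∀ {k} {f : Fin k → Fin k} → Bijective _≡_ _≡_ f → Bijective _≡_ _≡_ (preimage f)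
preimage-bijective {k} {f} (f-injective , f-surjective) = injective , surjective
  where
  f⁻¹ : Fin k → Fin k
  f⁻¹ y = proj₁ (f-surjective y)

  f∘f⁻¹ : ∀ y → f (f⁻¹ y) ≡ y
  f∘f⁻¹ y = proj₂ (f-surjective y) refl

  f⁻¹∘f : ∀ x → f⁻¹ (f x) ≡ x
  f⁻¹∘f x = f-injective (f∘f⁻¹ (f x))

  preimage-⊆ : ∀ {E E′} → preimage f E ⊆ preimage f E′ → E ⊆ E′
  preimage-⊆ sub {y} y∈E =
    subst (_∈ _) (f∘f⁻¹ y) (∈-preimage⁻ (sub (∈-preimage⁺ (subst (_∈ _) (sym (f∘f⁻¹ y)) y∈E))))

  injective : Injective _≡_ _≡_ (preimage f)
  injective eq = ⊆-antisym (preimage-⊆ (subst (_ ⊆_) eq id)) (preimage-⊆ (subst (_⊆ _) eq id))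

  surjective : Surjective _≡_ _≡_ (preimage f)
  surjective A = preimage f⁻¹ A , λ { refl → ⊆-antisym
    (λ x∈ → subst (_∈ A) (f⁻¹∘f _) (∈-preimage⁻ (∈-preimage⁻ x∈)))
    (λ x∈ → ∈-preimage⁺ (∈-preimage⁺ (subst (_∈ A) (sym (f⁻¹∘f _)) x∈))) }

∈-allSubsets : ∀ {k} (A : Subset k) → A ∈ₗ allSubsets k
∈-allSubsets []                  = here refl
∈-allSubsets {suc k} (true  ∷ A) = ∈-++⁺ˡ (∈-map⁺ (true ∷_) (∈-allSubsets A))
∈-allSubsets {suc k} (false ∷ A) = ∈-++⁺ʳ (map (true ∷_) (allSubsets k)) (∈-map⁺ (false ∷_) (∈-allSubsets A))

allSubsets-unique : ∀ k → Unique (allSubsets k)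
allSubsets-unique zero    = All.[] AllPairs.∷ AllPairs.[]
allSubsets-unique (suc k) =
  ++⁺ (map⁺ ∷-injectiveʳ (allSubsets-unique k)) (map⁺ ∷-injectiveʳ (allSubsets-unique k)) heads-differ
  where
  heads-differ : ∀ {A} → A ∈ₗ map (true ∷_) (allSubsets k) × A ∈ₗ map (false ∷_) (allSubsets k) → ⊥
  heads-differ (A∈₁ , A∈₂) with ∈-map⁻ (true ∷_) A∈₁ | ∈-map⁻ (false ∷_) A∈₂
  ... | _ , _ , refl | _ , _ , ()

filterᵇ-map : ∀ {A B : Set} (p : B → Bool) (f : A → B) xs →
  filterᵇ p (map f xs) ≡ map f (filterᵇ (p ∘ f) xs)
filterᵇ-map p f []       = refl
filterᵇ-map p f (x ∷ xs) with p (f x)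
... | true  = cong (f x ∷_) (filterᵇ-map p f xs)
... | false = filterᵇ-map p f xs

card-cong : ∀ {k} {G G′ : Family k} → G ≐ G′ → card G ≡ card G′
card-cong {k} G≐G′ = cong length (filter-≐ (T? ∘ _) (T? ∘ _)
  ((λ {A} → subst T (G≐G′ A)) , (λ {A} → subst T (sym (G≐G′ A)))) (allSubsets k))

card-∘ : ∀ {k} (G : Family k) {Ψ : Subset k → Subset k} → Bijective _≡_ _≡_ Ψ → card (G ∘ Ψ) ≡ card G
card-∘ {k} G {Ψ} (Ψ-injective , Ψ-surjective) = begin
  length (filterᵇ (G ∘ Ψ) (allSubsets k))         ≡⟨ length-map Ψ (filterᵇ (G ∘ Ψ) (allSubsets k)) ⟨
  length (map Ψ (filterᵇ (G ∘ Ψ) (allSubsets k))) ≡⟨ cong length (filterᵇ-map G Ψ (allSubsets k)) ⟨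
  length (filterᵇ G (map Ψ (allSubsets k)))       ≡⟨ ↭-length (filter-↭ (T? ∘ G) Ψ-permutes) ⟩
  length (filterᵇ G (allSubsets k))               ∎
  where
  open ≡-Reasoning
  Ψ-permutes : map Ψ (allSubsets k) ↭ allSubsets k
  Ψ-permutes = ∼bag⇒↭ (unique∧set⇒bag (map⁺ Ψ-injective (allSubsets-unique k)) (allSubsets-unique k)
    (λ {A} → mk⇔ (λ _ → ∈-allSubsets A)
      (λ _ → let (B , ΨB≡A) = Ψ-surjective A in subst (_∈ₗ _) (ΨB≡A refl) (∈-map⁺ Ψ (∈-allSubsets B)))))

Covers : ∀ {k} → Family k → Set
Covers {k} G = ∀ (x : Fin k) → ∃ λ A → A ∈ᶠ G × x ∈ A

MembersNonempty : ∀ {k} → Family k → Set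
MembersNonempty G = ∀ A → A ∈ᶠ G → Nonempty A

families-over-Fin0-≐ : ∀ {G G′ : Family 0} → MembersNonempty G → MembersNonempty G′ → G ≐ G′
families-over-Fin0-≐ G-nonempty G′-nonempty [] = T-injective (absurd ∘ G-nonempty []) (absurd ∘ G′-nonempty [])
  where
  absurd : ∀ {b} → Nonempty {0} [] → T b
  absurd (() , _)

_⟦_⟧⊆_ : ∀ {k} → (Fin k → Fin k) → Subset k → Subset k → Set
f ⟦ A ⟧⊆ E = ∀ {x} → x ∈ A → f x ∈ E

module _ {k} (_∗_ : Op k) where

  ∈-⟪⟫⁺ : ∀ {A B a b} → a ∈ A → b ∈ B → a ∗ b ∈ A ⟪ _∗_ ⟫ B
  ∈-⟪⟫⁺ {a = a} {b} a∈A b∈B = ∈-tabulate⁺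
    (T-any⁺ _ (∈-allFin a) (T-any⁺ _ (∈-allFin b)
      (from T-∧ (∈⇒T-lookup a∈A , from T-∧ (∈⇒T-lookup b∈B , T-does⁺ ((a ∗ b) ≟ᶠ (a ∗ b)) refl)))))

  ∈-⟪⟫⁻ : ∀ {A B x} → x ∈ A ⟪ _∗_ ⟫ B → ∃₂ λ a b → a ∈ A × b ∈ B × a ∗ b ≡ x
  ∈-⟪⟫⁻ x∈A∗B
    with a , ∃b ← T-any⁻ _ (allFin k) (∈-tabulate⁻ x∈A∗B)
    with b , a∈A∧b∈B∧ab≡x ← T-any⁻ _ (allFin k) ∃b
    with a∈A , b∈B∧ab≡x ← to T-∧ a∈A∧b∈B∧ab≡x
    with b∈B , ab≡x ← to T-∧ b∈B∧ab≡x
    = a , b , T-lookup⇒∈ a∈A , T-lookup⇒∈ b∈B , T-does⁻ ((a ∗ b) ≟ᶠ _) ab≡x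

  ∈-star⁺ : ∀ (G : Family k) {A B} → A ∈ᶠ G → B ∈ᶠ G → (A ⟪ _∗_ ⟫ B) ∈ᶠ star _∗_ G
  ∈-star⁺ G {A} {B} A∈G B∈G = T-any⁺ _ (∈-allSubsets A) (T-any⁺ _ (∈-allSubsets B)
    (from T-∧ (A∈G , from T-∧ (B∈G , T-does⁺ (≡-dec _≟ᵇ_ (A ⟪ _∗_ ⟫ B) (A ⟪ _∗_ ⟫ B)) refl))))

  ∈-star⁻ : ∀ (G : Family k) {C} → C ∈ᶠ star _∗_ G → ∃₂ λ A B → A ∈ᶠ G × B ∈ᶠ G × A ⟪ _∗_ ⟫ B ≡ C
  ∈-star⁻ G C∈G*
    with A , ∃B ← T-any⁻ _ (allSubsets k) C∈G*
    with B , A∈G∧B∈G∧AB≡C ← T-any⁻ _ (allSubsets k) ∃B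
    with A∈G , B∈G∧AB≡C ← to T-∧ A∈G∧B∈G∧AB≡C
    with B∈G , AB≡C ← to T-∧ B∈G∧AB≡C
    = A , B , A∈G , B∈G , T-does⁻ (≡-dec _≟ᵇ_ (A ⟪ _∗_ ⟫ B) _) AB≡C

  star-cong : ∀ {G G′ : Family k} → G ≐ G′ → star _∗_ G ≐ star _∗_ G′
  star-cong G≐G′ C = T-injective (transport G≐G′) (transport (sym ∘ G≐G′))
    where
    transport : ∀ {H H′ : Family k} → H ≐ H′ → C ∈ᶠ star _∗_ H → C ∈ᶠ star _∗_ H′
    transport {H} {H′} H≐H′ C∈H* with A , B , A∈H , B∈H , refl ← ∈-star⁻ H C∈H* =
      ∈-star⁺ H′ (subst T (H≐H′ A) A∈H) (subst T (H≐H′ B) B∈H)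

  starN-cong : ∀ {G G′ : Family k} → G ≐ G′ → ∀ n → starN _∗_ n G ≐ starN _∗_ n G′
  starN-cong G≐G′ zero    = G≐G′
  starN-cong G≐G′ (suc n) = star-cong (starN-cong G≐G′ n)

  starN-+ : ∀ m n (G : Family k) → starN _∗_ (m + n) G ≐ starN _∗_ m (starN _∗_ n G)
  starN-+ zero    n G A = refl
  starN-+ (suc m) n G   = star-cong (starN-+ m n G)

  translate : List (Fin k) → Fin k → Fin k
  translate []       = id
  translate (b ∷ bs) = (_∗ b) ∘ translate bs

  translate-++ : ∀ bs cs x → translate (bs ++ cs) x ≡ translate bs (translate cs x)
  translate-++ []       cs x = refl
  translate-++ (b ∷ bs) cs x = cong (_∗ b) (translate-++ bs cs x)

  star-nonempty : ∀ {G} → MembersNonempty G → MembersNonempty (star _∗_ G)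
  star-nonempty {G} nonempty C C∈G*
    with A , B , A∈G , B∈G , refl ← ∈-star⁻ G C∈G*
    with a , a∈A ← nonempty A A∈G
    with b , b∈B ← nonempty B B∈G
    = a ∗ b , ∈-⟪⟫⁺ a∈A b∈B

  starN-nonempty : ∀ {G} → MembersNonempty G → ∀ n → MembersNonempty (starN _∗_ n G)
  starN-nonempty nonempty zero    = nonempty
  starN-nonempty nonempty (suc n) = star-nonempty (starN-nonempty nonempty n)

  starN-⊇-translate : ∀ {G} → MembersNonempty G → ∀ n {E} → E ∈ᶠ starN _∗_ n G →
    ∃₂ λ A bs → A ∈ᶠ G × length bs ≡ n × translate bs ⟦ A ⟧⊆ E
  starN-⊇-translate nonempty zero {E} E∈G = E , [] , E∈G , refl , id
  starN-⊇-translate {G} nonempty (suc n) E∈Gⁿ⁺¹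
    with D , C , D∈Gⁿ , C∈Gⁿ , refl ← ∈-star⁻ (starN _∗_ n G) E∈Gⁿ⁺¹
    with A , bs , A∈G , |bs|≡n , bs⟦A⟧⊆D ← starN-⊇-translate nonempty n D∈Gⁿ
    with c , c∈C ← starN-nonempty nonempty n C C∈Gⁿ
    = A , c ∷ bs , A∈G , cong suc |bs|≡n , λ x∈A → ∈-⟪⟫⁺ (bs⟦A⟧⊆D x∈A) c∈C

  module _ (up : UniformityPreserving _∗_) where

    translate-bijective : ∀ bs → Bijective _≡_ _≡_ (translate bs)
    translate-bijective []       = Identity.bijective _≡_
    translate-bijective (b ∷ bs) = Composition.bijective _≡_ _≡_ _≡_ (translate-bijective bs) (up b)

    star-covers : ∀ {G} → Covers G → Covers (star _∗_ G)
    star-covers {G} covers x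
      with y , yx≡x ← proj₂ (up x) x
      with D , D∈G , y∈D ← covers y
      with C , C∈G , x∈C ← covers x
      = D ⟪ _∗_ ⟫ C , ∈-star⁺ G D∈G C∈G , subst (_∈ _) (yx≡x refl) (∈-⟪⟫⁺ y∈D x∈C)

    starN-covers : ∀ {G} → Covers G → ∀ n → Covers (starN _∗_ n G)
    starN-covers covers zero    = covers
    starN-covers covers (suc n) = star-covers (starN-covers covers n)

    translate-into-starN : ∀ {G} → Covers G → ∀ {A} → A ∈ᶠ G → ∀ bs →
      ∃ λ E → E ∈ᶠ starN _∗_ (length bs) G × translate bs ⟦ A ⟧⊆ E
    translate-into-starN covers {A} A∈G [] = A , A∈G , id
    translate-into-starN {G} covers A∈G (b ∷ bs)
      with D , D∈Gⁿ , bs⟦A⟧⊆D ← translate-into-starN covers A∈G bs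
      with C , C∈Gⁿ , b∈C ← starN-covers covers (length bs) b
      = D ⟪ _∗_ ⟫ C , ∈-star⁺ (starN _∗_ (length bs) G) D∈Gⁿ C∈Gⁿ , λ x∈A → ∈-⟪⟫⁺ (bs⟦A⟧⊆D x∈A) b∈C

module Partition {k} (_∗_ : Op k) (up : UniformityPreserving _∗_)
                 (ℋ : Family k) (partition : IsPartition ℋ) where

  private
    nonempty : MembersNonempty ℋ
    nonempty = proj₁ partition

    covers : Covers ℋ
    covers = proj₁ (proj₂ partition)

    disjoint : ∀ x {A B} → A ∈ᶠ ℋ → B ∈ᶠ ℋ → x ∈ A → x ∈ B → A ≡ B
    disjoint x A∈ℋ B∈ℋ = proj₂ (proj₂ partition) x _ _ A∈ℋ B∈ℋ

    τ : List (Fin k) → Fin k → Fin k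
    τ = translate _∗_

  Stable : ℕ → Set
  Stable l = starN _∗_ l ℋ ≐ ℋ

  _~_ : Fin k → Fin k → Set
  x ~ y = ∃ λ A → A ∈ᶠ ℋ × x ∈ A × y ∈ A

  ~-block : ∀ {x y A} → x ~ y → A ∈ᶠ ℋ → y ∈ A → x ∈ A
  ~-block (B , B∈ℋ , x∈B , y∈B) A∈ℋ y∈A = subst (_ ∈_) (disjoint _ B∈ℋ A∈ℋ y∈B y∈A) x∈B

  translate-~ : ∀ n bs → Stable (length bs + n) → ∀ {E x y} → E ∈ᶠ starN _∗_ n ℋ → x ∈ E → y ∈ E →
    τ bs x ~ τ bs y
  translate-~ n bs stable E∈ℋⁿ x∈E y∈E
    with E′ , E′∈ , bs⟦E⟧⊆E′ ← translate-into-starN _∗_ up (starN-covers _∗_ up covers n) E∈ℋⁿ bs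
    = E′ , subst T (trans (sym (starN-+ _∗_ (length bs) n ℋ E′)) (stable E′)) E′∈ , bs⟦E⟧⊆E′ x∈E , bs⟦E⟧⊆E′ y∈E

  translate-preserves-~ : ∀ bs → Stable (length bs) → ∀ {x y} → x ~ y → τ bs x ~ τ bs y
  translate-preserves-~ bs stable (A , A∈ℋ , x∈A , y∈A) =
    translate-~ 0 bs (subst Stable (sym (+-identityʳ (length bs))) stable) A∈ℋ x∈A y∈A

  translate-reflects-~ : ∀ bs → Stable (length bs) → ∀ {x y} → τ bs x ~ τ bs y → x ~ y
  translate-reflects-~ bs stable {x} {y} fx~fy
    with d , fᵈ⁺¹x≡x , fᵈ⁺¹y≡y ← fold-returns₂ (proj₁ (translate-bijective _∗_ up bs)) x y
    = subst₂ _~_ (shift x fᵈ⁺¹x≡x) (shift y fᵈ⁺¹y≡y) (fold-preserves d fx~fy)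
    where
    f : Fin k → Fin k
    f = τ bs

    fold-preserves : ∀ t {x y} → x ~ y → fold x f t ~ fold y f t
    fold-preserves zero    x~y = x~y
    fold-preserves (suc t) x~y = translate-preserves-~ bs stable (fold-preserves t x~y)

    shift : ∀ z → fold z f (suc d) ≡ z → fold (f z) f d ≡ z
    shift z fᵈ⁺¹z≡z = trans (iterate-is-fold (f z) f d) (trans (sym (iterate-is-fold z f (suc d))) fᵈ⁺¹z≡z)

  module Periodic (p : ℕ) (periodic : Stable (suc p)) where

    stable-multiple : ∀ j → Stable (j * suc p)
    stable-multiple zero    A = refl
    stable-multiple (suc j) A = begin
      starN _∗_ (suc p + j * suc p) ℋ A          ≡⟨ starN-+ _∗_ (suc p) (j * suc p) ℋ A ⟩
      starN _∗_ (suc p) (starN _∗_ (j * suc p) ℋ) A ≡⟨ starN-cong _∗_ (stable-multiple j) (suc p) A ⟩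
      starN _∗_ (suc p) ℋ A                      ≡⟨ periodic A ⟩
      ℋ A                                        ∎
      where open ≡-Reasoning

    module _ (c : Fin k) (n : ℕ) where

      cs pad : List (Fin k)
      cs  = replicate n c
      pad = replicate (n * p) c

      ρ : Fin k → Fin k
      ρ = τ cs

      stable-pad : Stable (length pad + n)
      stable-pad = subst Stable (sym (begin
        length pad + n ≡⟨ cong (_+ n) (length-replicate (n * p)) ⟩
        n * p + n      ≡⟨ +-comm (n * p) n ⟩
        n + n * p      ≡⟨ *-suc n p ⟨
        n * suc p      ∎)) (stable-multiple n)
        where open ≡-Reasoning

      stable-pad++ : ∀ {gs} → length gs ≡ n → Stable (length (pad ++ gs))
      stable-pad++ {gs} |gs|≡n =
        subst Stable (sym (trans (length-++ pad) (cong (length pad +_) |gs|≡n))) stable-pad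

      τ-pad++ : ∀ gs x → τ (pad ++ gs) x ≡ τ pad (τ gs x)
      τ-pad++ = translate-++ _∗_ pad

      preimage-of-member : ∀ {E} → E ∈ᶠ starN _∗_ n ℋ → preimage ρ E ∈ᶠ ℋ
      preimage-of-member {E} E∈ℋⁿ
        with A₀ , gs , A₀∈ℋ , |gs|≡n , gs⟦A₀⟧⊆E ← starN-⊇-translate _∗_ nonempty n E∈ℋⁿ
        with a₀ , a₀∈A₀ ← nonempty A₀ A₀∈ℋ
        with w₀ , ρw₀≡ ← proj₂ (translate-bijective _∗_ up cs) (τ gs a₀)
        with A , A∈ℋ , w₀∈A ← covers w₀
        = subst (_∈ᶠ ℋ) (⊆-antisym A⊆preimage preimage⊆A) A∈ℋ
        where
        ρw₀≡x₀ : ρ w₀ ≡ τ gs a₀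
        ρw₀≡x₀ = ρw₀≡ refl

        x₀∈E : τ gs a₀ ∈ E
        x₀∈E = gs⟦A₀⟧⊆E a₀∈A₀

        preimage⊆A : preimage ρ E ⊆ A
        preimage⊆A {w} w∈ = ~-block (translate-reflects-~ (pad ++ cs) (stable-pad++ (length-replicate n))
          (subst₂ _~_ (sym (τ-pad++ cs w)) (sym (trans (τ-pad++ cs w₀) (cong (τ pad) ρw₀≡x₀)))
            (translate-~ n pad stable-pad E∈ℋⁿ (∈-preimage⁻ w∈) x₀∈E))) A∈ℋ w₀∈A

        A⊆preimage : A ⊆ preimage ρ E
        A⊆preimage {w} w∈A with v , τv≡ ← proj₂ (translate-bijective _∗_ up gs) (ρ w) =
          ∈-preimage⁺ (subst (_∈ E) (τv≡ refl) (gs⟦A₀⟧⊆E (~-block v~a₀ A₀∈ℋ a₀∈A₀)))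
          where
          v~a₀ : v ~ a₀
          v~a₀ = translate-reflects-~ (pad ++ gs) (stable-pad++ |gs|≡n) (subst₂ _~_
            (trans (τ-pad++ cs w)  (trans (cong (τ pad) (sym (τv≡ refl))) (sym (τ-pad++ gs v))))
            (trans (τ-pad++ cs w₀) (trans (cong (τ pad) ρw₀≡x₀) (sym (τ-pad++ gs a₀))))
            (translate-preserves-~ (pad ++ cs) (stable-pad++ (length-replicate n)) (A , A∈ℋ , w∈A , w₀∈A)))

      member-of-preimage : ∀ {E} → preimage ρ E ∈ᶠ ℋ → E ∈ᶠ starN _∗_ n ℋ
      member-of-preimage {E} ρ⁻¹E∈ℋ
        with D , D∈ , cs⟦ρ⁻¹E⟧⊆D ← translate-into-starN _∗_ up covers ρ⁻¹E∈ℋ cs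
        with w , w∈ρ⁻¹E ← nonempty _ ρ⁻¹E∈ℋ
        = subst (_∈ᶠ starN _∗_ n ℋ) D≡E D∈ℋⁿ
        where
        D∈ℋⁿ : D ∈ᶠ starN _∗_ n ℋ
        D∈ℋⁿ = subst (λ m → D ∈ᶠ starN _∗_ m ℋ) (length-replicate n) D∈

        D≡E : D ≡ E
        D≡E = proj₁ (preimage-bijective (translate-bijective _∗_ up cs))
          (disjoint w (preimage-of-member D∈ℋⁿ) ρ⁻¹E∈ℋ (∈-preimage⁺ (cs⟦ρ⁻¹E⟧⊆D w∈ρ⁻¹E)) w∈ρ⁻¹E)

      starN-≐-preimage : starN _∗_ n ℋ ≐ (ℋ ∘ preimage ρ)
      starN-≐-preimage E = T-injective preimage-of-member member-of-preimage

      card-starN : card (starN _∗_ n ℋ) ≡ card ℋ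
      card-starN = trans (card-cong starN-≐-preimage)
                         (card-∘ ℋ (preimage-bijective (translate-bijective _∗_ up cs)))

mainTheorem8 : ∀ (k : ℕ) (_∗_ : Op k) → UniformityPreserving _∗_ →
    ∀ (ℋ : Family k) → IsPartition ℋ → Periodic _∗_ ℋ →
    ∀ (n : ℕ) → card (starN _∗_ (suc n) ℋ) ≡ card ℋ
-- With 𝒳 empty there is no point c to translate by, but then both families are empty.
mainTheorem8 zero _∗_ up ℋ partition _ n =
  card-cong (families-over-Fin0-≐ (starN-nonempty _∗_ (proj₁ partition) (suc n)) (proj₁ partition))
mainTheorem8 (suc k) _∗_ up ℋ partition (p , periodic) n =
  Partition.Periodic.card-starN _∗_ up ℋ partition p periodic zero (suc n)
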